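{- If $G$ is a connected graph, then ${\rm gp}(G)\ge \omega(G_{\rm SR})$. Moreover, equality holds if and only if $G$ contains a gp-set that induces a complete subgraph of $G_{\rm SR}$.
   Context: All graphs are finite and simple. For a connected graph $G$, a set $S\subseteq V(G)$ is a general position set if no three pairwise distinct vertices of $S$ lie on a common geodesic (shortest path) of $G$; ${\rm gp}(G)$ is the maximum cardinality of a general position set, and a general position set of cardinality ${\rm gp}(G)$ is called a gp-set. A vertex $u$ is maximally distant from $v$ if every neighbor $w$ of $u$ satisfies $d_G(v,w)\le d_G(u,v)$; $u$ and $v$ are mutually maximally distant (MMD) if each is maximally distant from the other. The strong resolving graph $G_{\rm SR}$ has vertex set $V(G)$, two vertices being adjacent iff they are MMD in $G$. $\omega$ denotes the clique number. -}

module Defs where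

open import Level using (0ℓ)
open import Data.Nat using (ℕ; zero; suc; _≤_)
open import Data.Fin using (Fin)
open import Data.List using (List; length)
open import Data.List.Membership.Propositional using (_∈_)
open import Data.List.Relation.Unary.Unique.Propositional using (Unique)
open import Data.Product using (Σ; ∃; _×_; _,_)
open import Relation.Binary.PropositionalEquality using (_≡_; _≢_)
open import Relation.Nullary using (¬_)

record Graph (n : ℕ) : Set₁ where
  field
    Adj      : Fin n → Fin n → Set
    sym      : ∀ {u v} → Adj u v → Adj v u
    irrefl   : ∀ {u} → ¬ Adj u u
open Graph public

module _ {n : ℕ} (G : Graph n) where

  data Walk : Fin n → Fin n → Set where
    [_] : ∀ u → Walk u u
    _∷_ : ∀ {u w v} → Adj G u w → Walk w v → Walk u v

  len : ∀ {u v} → Walk u v → ℕ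
  len [ _ ]    = zero
  len (_ ∷ p)  = suc (len p)

  data OnWalk (x : Fin n) : ∀ {u v} → Walk u v → Set where
    here-end : OnWalk x [ x ]
    here     : ∀ {w v} (e : Adj G x w) (p : Walk w v) → OnWalk x (e ∷ p)
    there    : ∀ {u w v} (e : Adj G u w) {p : Walk w v} → OnWalk x p → OnWalk x (e ∷ p)

  Connected : Set
  Connected = ∀ u v → Walk u v

  IsGeodesic : ∀ {u v} → Walk u v → Set
  IsGeodesic {u} {v} p = ∀ (q : Walk u v) → len p ≤ len q

  Dist : Fin n → Fin n → ℕ → Set
  Dist u v k = Σ (Walk u v) (λ p → IsGeodesic p × len p ≡ k)

  OnCommonGeodesic : Fin n → Fin n → Fin n → Set
  OnCommonGeodesic x y z =
    ∃ λ a → ∃ λ b → Σ (Walk a b) λ p →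
      IsGeodesic p × OnWalk x p × OnWalk y p × OnWalk z p

  -- vertex sets are duplicate-free lists; cardinality = length
  IsGeneralPosition : List (Fin n) → Set
  IsGeneralPosition S =
    Unique S ×
    (∀ {x y z} → x ∈ S → y ∈ S → z ∈ S →
       x ≢ y → y ≢ z → x ≢ z → ¬ OnCommonGeodesic x y z)

  IsGpNumber : ℕ → Set
  IsGpNumber k =
    (∃ λ S → IsGeneralPosition S × length S ≡ k) ×
    (∀ S → IsGeneralPosition S → length S ≤ k)

  IsGpSet : List (Fin n) → Set
  IsGpSet S = IsGeneralPosition S × (∀ T → IsGeneralPosition T → length T ≤ length S)

  MaximallyDistant : Fin n → Fin n → Set
  MaximallyDistant u v =
    ∀ {w k m} → Adj G u w → Dist v w k → Dist u v m → k ≤ m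

  MMD : Fin n → Fin n → Set
  MMD u v = MaximallyDistant u v × MaximallyDistant v u

SR : ∀ {n} → Graph n → Graph n
SR {n} G = record
  { Adj = λ u v → u ≢ v × MMD G u v
  ; sym = λ { (u≢v , m₁ , m₂) → (λ e → u≢v (symm e)) , m₂ , m₁ }
  ; irrefl = λ { (u≢u , _) → u≢u _≡_.refl }
  }
  where
  symm : ∀ {a b : Fin n} → a ≡ b → b ≡ a
  symm _≡_.refl = _≡_.refl

module _ {n : ℕ} (G : Graph n) where

  IsClique : List (Fin n) → Set
  IsClique S = Unique S × (∀ {x y} → x ∈ S → y ∈ S → x ≢ y → Adj G x y)

  IsCliqueNumber : ℕ → Set
  IsCliqueNumber k =
    (∃ λ S → IsClique S × length S ≡ k) ×
    (∀ S → IsClique S → length S ≤ k)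

module Submission where

-- A clique of the strong resolving graph G_SR is a set of
-- pairwise mutually maximally distant (MMD) vertices, and such a set is in
-- general position: if three of its vertices lay on a geodesic P, let x be
-- the one met first on P.  Of the two others, at least one, say y, is not
-- the last vertex of P, so P continues from y to a neighbour w of y with
-- d(x,w) = d(x,y) + 1, contradicting that y is maximally distant from x.
-- Hence ω(G_SR) ≤ gp(G), and a maximum clique of G_SR is a gp-set exactly
-- when gp(G) = ω(G_SR), which gives the equivalence.

open import Defs hiding (sym)
open import Data.Nat using (ℕ; _≤_; suc; _+_; s≤s)
open import Data.Nat.Properties
  using (+-comm; +-cancelʳ-≤; n≮n; ≤-trans; ≤-antisym; module ≤-Reasoning)
open import Data.Fin using (Fin; _≟_)
open import Data.List using (List; length)
open import Data.Product using (∃; _×_; _,_; proj₁; proj₂)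
open import Relation.Binary.PropositionalEquality
  using (_≡_; refl; sym; trans; cong; subst; subst₂; _≢_; module ≡-Reasoning)
open import Function.Bundles using (_⇔_; mk⇔)
open import Data.Empty using (⊥; ⊥-elim)
open import Relation.Nullary using (yes; no)

module Walks {n : ℕ} (G : Graph n) where

  infixr 5 _++_

  _++_ : ∀ {a b c} → Walk G a b → Walk G b c → Walk G a c
  [ _ ]   ++ q = q
  (e ∷ p) ++ q = e ∷ (p ++ q)

  len-++ : ∀ {a b c} (p : Walk G a b) (q : Walk G b c) →
    len G (p ++ q) ≡ len G p + len G q
  len-++ [ _ ]   q = refl
  len-++ (e ∷ p) q = cong suc (len-++ p q)

  ++-assoc : ∀ {a b c d} (p : Walk G a b) (q : Walk G b c) (r : Walk G c d) →
    (p ++ q) ++ r ≡ p ++ (q ++ r)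
  ++-assoc [ _ ]   q r = refl
  ++-assoc (e ∷ p) q r = cong (e ∷_) (++-assoc p q r)

  reverse : ∀ {a b} → Walk G a b → Walk G b a
  reverse [ u ]   = [ u ]
  reverse (e ∷ p) = reverse p ++ (Graph.sym G e ∷ [ _ ])

  len-reverse : ∀ {a b} (p : Walk G a b) → len G (reverse p) ≡ len G p
  len-reverse [ u ]   = refl
  len-reverse (e ∷ p) = begin
    len G (reverse p ++ (Graph.sym G e ∷ [ _ ])) ≡⟨ len-++ (reverse p) _ ⟩
    len G (reverse p) + 1                        ≡⟨ cong (_+ 1) (len-reverse p) ⟩
    len G p + 1                                  ≡⟨ +-comm (len G p) 1 ⟩
    suc (len G p)                                ∎
    where open ≡-Reasoning

  reverse-geodesic : ∀ {a b} (p : Walk G a b) → IsGeodesic G p → IsGeodesic G (reverse p)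
  reverse-geodesic p geo q =
    subst₂ _≤_ (sym (len-reverse p)) (len-reverse q) (geo (reverse q))

  -- Every prefix of a geodesic is a geodesic (otherwise a shorter prefix
  -- followed by the same suffix would beat the geodesic).
  prefix-geodesic : ∀ {a b c} (p : Walk G a b) (q : Walk G b c) →
    IsGeodesic G (p ++ q) → IsGeodesic G p
  prefix-geodesic p q geo r =
    +-cancelʳ-≤ (len G q) (len G p) (len G r)
      (subst₂ _≤_ (len-++ p q) (len-++ r q) (geo (r ++ q)))

  tail-geodesic : ∀ {a w b} (e : Adj G a w) (p : Walk G w b) →
    IsGeodesic G (e ∷ p) → IsGeodesic G p
  tail-geodesic e p geo q with geo (e ∷ q)
  ... | s≤s le = le

  data SplitAt (y : Fin n) : ∀ {a b} → Walk G a b → Set where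
    split : ∀ {a w b} (before : Walk G a y) (e : Adj G y w) (after : Walk G w b) →
      SplitAt y (before ++ (e ∷ after))

  splitAt : ∀ {y a b} (p : Walk G a b) → OnWalk G y p → y ≢ b → SplitAt y p
  splitAt _       here-end     y≢b = ⊥-elim (y≢b refl)
  splitAt _       (here e p)   y≢b = split [ _ ] e p
  splitAt (e ∷ p) (there .e o) y≢b with splitAt p o y≢b
  ... | split before e′ after = split (e ∷ before) e′ after

  onWalk-trivial : ∀ {x u} → OnWalk G x [ u ] → x ≡ u
  onWalk-trivial here-end = refl

module Geodesics {n : ℕ} (G : Graph n) where
  open Walks G

  -- An inner vertex y of a geodesic starting at x is not maximally distant
  -- from x: its successor w on the geodesic satisfies d(x,w) = d(x,y) + 1.
  inner-not-maximally-distant : ∀ {x y b} (p : Walk G x b) → IsGeodesic G p →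
    OnWalk G y p → y ≢ b → MaximallyDistant G y x → ⊥
  inner-not-maximally-distant p geo y∈p y≢b md with splitAt p y∈p y≢b
  ... | split {w = w} before e after = n≮n (len G before) successor-farther
    where
    toSuccessor : Walk G _ w
    toSuccessor = before ++ (e ∷ [ w ])

    toSuccessor-geodesic : IsGeodesic G toSuccessor
    toSuccessor-geodesic = prefix-geodesic toSuccessor after
      (subst (IsGeodesic G) (sym (++-assoc before (e ∷ [ w ]) after)) geo)

    before-geodesic : IsGeodesic G before
    before-geodesic = prefix-geodesic before (e ∷ after) geo

    successor-farther : suc (len G before) ≤ len G before
    successor-farther = begin
      suc (len G before)     ≡⟨ +-comm 1 (len G before) ⟩
      len G before + 1       ≡⟨ len-++ before (e ∷ [ w ]) ⟨
      len G toSuccessor      ≤⟨ md e (toSuccessor , toSuccessor-geodesic , refl)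
                                     (reverse before , reverse-geodesic before before-geodesic , refl) ⟩
      len G (reverse before) ≡⟨ len-reverse before ⟩
      len G before           ∎
      where open ≤-Reasoning

  -- Two distinct vertices of a geodesic starting at x cannot both be
  -- maximally distant from x, since one of them is an inner vertex.
  not-two-maximally-distant : ∀ {x y z b} (p : Walk G x b) → IsGeodesic G p →
    OnWalk G y p → OnWalk G z p → y ≢ z →
    MaximallyDistant G y x → MaximallyDistant G z x → ⊥
  not-two-maximally-distant {y = y} {z} {b} p geo y∈p z∈p y≢z mdy mdz with y ≟ b
  ... | no  y≢b  = inner-not-maximally-distant p geo y∈p y≢b mdy
  ... | yes refl = inner-not-maximally-distant p geo z∈p (λ z≡y → y≢z (sym z≡y)) mdz

  -- We
  -- drop edges from the front of the geodesic until it starts at the first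
  -- of the three vertices and then apply the previous lemma.
  no-MMD-triple-on-geodesic : ∀ {a b x y z} (p : Walk G a b) → IsGeodesic G p →
    OnWalk G x p → OnWalk G y p → OnWalk G z p →
    x ≢ y → y ≢ z → x ≢ z → MMD G x y → MMD G y z → MMD G x z → ⊥
  no-MMD-triple-on-geodesic _ _ here-end y∈p _ x≢y _ _ _ _ _ =
    x≢y (sym (onWalk-trivial y∈p))
  no-MMD-triple-on-geodesic p geo (here _ _) y∈p z∈p _ y≢z _ xy _ xz =
    not-two-maximally-distant p geo y∈p z∈p y≢z (proj₂ xy) (proj₂ xz)
  no-MMD-triple-on-geodesic p geo x∈p@(there _ _) (here _ _) z∈p _ _ x≢z xy yz _ =
    not-two-maximally-distant p geo x∈p z∈p x≢z (proj₁ xy) (proj₂ yz)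
  no-MMD-triple-on-geodesic p geo x∈p@(there _ _) y∈p@(there _ _) (here _ _) x≢y _ _ _ yz xz =
    not-two-maximally-distant p geo x∈p y∈p x≢y (proj₁ xz) (proj₁ yz)
  no-MMD-triple-on-geodesic (e ∷ p) geo (there _ x∈p) (there _ y∈p) (there _ z∈p) =
    no-MMD-triple-on-geodesic p (tail-geodesic e p geo) x∈p y∈p z∈p

  clique-general-position : ∀ S → IsClique (SR G) S → IsGeneralPosition G S
  clique-general-position S (unique , adjacent) =
    unique , λ x∈S y∈S z∈S x≢y y≢z x≢z (_ , _ , p , geo , x∈p , y∈p , z∈p) →
      no-MMD-triple-on-geodesic p geo x∈p y∈p z∈p x≢y y≢z x≢z
        (proj₂ (adjacent x∈S y∈S x≢y)) (proj₂ (adjacent y∈S z∈S y≢z))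
        (proj₂ (adjacent x∈S z∈S x≢z))

theorem3p1 : ∀ {n} (G : Graph n) → Connected G →
    ∀ (gp ω : ℕ) → IsGpNumber G gp → IsCliqueNumber (SR G) ω →
    (ω ≤ gp) × ((gp ≡ ω) ⇔ (∃ λ (S : List (Fin n)) → IsGpSet G S × IsClique (SR G) S))
theorem3p1 G _ gp ω ((S₀ , S₀-gp , |S₀|≡gp) , gp-max) ((C , C-clique , |C|≡ω) , ω-max) =
  ω≤gp , mk⇔ maximum-clique-is-gp-set gp-set-clique⇒equal
  where
  open Geodesics G

  ω≤gp : ω ≤ gp
  ω≤gp = subst (_≤ gp) |C|≡ω (gp-max C (clique-general-position C C-clique))

  maximum-clique-is-gp-set : gp ≡ ω → ∃ λ S → IsGpSet G S × IsClique (SR G) S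
  maximum-clique-is-gp-set gp≡ω =
    C , (clique-general-position C C-clique ,
         λ T T-gp → subst (length T ≤_) (trans gp≡ω (sym |C|≡ω)) (gp-max T T-gp)) ,
    C-clique

  gp-set-clique⇒equal : (∃ λ S → IsGpSet G S × IsClique (SR G) S) → gp ≡ ω
  gp-set-clique⇒equal (S , (_ , S-max) , S-clique) = ≤-antisym
    (≤-trans (subst (_≤ length S) |S₀|≡gp (S-max S₀ S₀-gp)) (ω-max S S-clique))
    ω≤gp
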